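{- Let $G=(V_G,E_G)$ be a hypergraph with $V_G=\{0,1,\dots,p\}\subset\mathbb{N}_0$ and $E_G$ a finite (multi)collection of nonempty subsets of $V_G$. Write each edge as the tuple of its nodes in strictly ascending order, order the edges in descending lexicographic order (where a proper prefix of a tuple is lexicographically smaller than the tuple), and let $T$ be the concatenation of these tuples in that order, a string of length $M_G=\sum_{e\in E_G}|e|$ over the alphabet $V_G$. Then for every position $j$ with $0\le j$ and $j+1\le M_G-1$: if $T[j+1]\le T[j]$, then $T[j+1..]<T[j..]$ in lexicographic order.
   Context: For a string $T=T[0]T[1]\cdots T[|T|-1]$, $T[i..]$ denotes the suffix $T[i]T[i+1]\cdots T[|T|-1]$. Strings over $\mathbb{N}_0$ are compared lexicographically, with a proper prefix of a string being smaller than that string. The collection $E_G$ may contain the same edge several times; each edge contains each of its nodes exactly once. -}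

module Defs where

open import Data.Nat using (ℕ; _<_; _≤_)
open import Data.List using (List; []; _∷_; concat)
open import Data.List.Relation.Unary.All using (All)
open import Data.List.Relation.Unary.Linked using (Linked)
open import Data.List.Relation.Binary.Lex.Strict using (Lex-<; Lex-≤)
open import Relation.Binary.PropositionalEquality using (_≡_)
open import Relation.Nullary using (¬_)
open import Data.Product using (_×_)

_<lex_ : List ℕ → List ℕ → Set
_<lex_ = Lex-< _≡_ _<_

_≤lex_ : List ℕ → List ℕ → Set
_≤lex_ = Lex-≤ _≡_ _<_

IsEdge : ℕ → List ℕ → Set
IsEdge p e = (¬ e ≡ []) × Linked _<_ e × All (_≤ p) e

DescLex : List (List ℕ) → Set
DescLex = Linked (λ e f → f ≤lex e)

stringT : List (List ℕ) → List ℕ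
stringT = concat

{-# OPTIONS --safe #-}
module Submission where

-- Inside an edge the string strictly ascends, so a descent T[j+1] ≤ T[j]
-- can only occur where an edge ends, say in the node x; then T[j..] is
-- x followed by the concatenation of the remaining edges.  By the descending
-- order the next edge is ≤lex its predecessor, hence ≤lex each of the
-- predecessor's (lexicographically larger) suffixes, in particular [x]: it either
-- starts below x, which decides the comparison, or equals [x], which shifts
-- the comparison one edge further.

open import Defs
open import Data.Nat using (ℕ; zero; suc; _≤_; _<_)
open import Data.Nat.Properties using (<-trans; <-resp₂-≡; <⇒≱)
open import Data.List using (List; []; _∷_; [_]; _++_; drop; concat)
open import Data.List.Relation.Unary.All using (All; []; _∷_)
open import Data.List.Relation.Unary.Linked as Linked using (Linked; [-]; _∷_)
open import Data.List.Relation.Binary.Lex.Core using (base; halt; this; next)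
open import Data.List.Relation.Binary.Lex.Strict using (≤-transitive)
open import Relation.Binary.PropositionalEquality using (_≡_; refl; isEquivalence)
open import Relation.Nullary using (contradiction)
open import Data.Product using (_,_)

≤lex-trans : ∀ {u v w} → u ≤lex v → v ≤lex w → u ≤lex w
≤lex-trans = ≤-transitive isEquivalence <-resp₂-≡ <-trans

descLex-weakenHead : ∀ {e e′ E} → e ≤lex e′ → DescLex (e ∷ E) → DescLex (e′ ∷ E)
descLex-weakenHead _    [-]          = [-]
descLex-weakenHead e≤e′ (f≤e ∷ desc) = ≤lex-trans f≤e e≤e′ ∷ desc

concat-<lex-∷ : ∀ {p x E} → All (IsEdge p) E → DescLex ([ x ] ∷ E) →
                concat E <lex (x ∷ concat E)
concat-<lex-∷ {E = []}          _                _              = halt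
concat-<lex-∷ {E = [] ∷ _}      ((e≢[] , _) ∷ _) _              = contradiction refl e≢[]
concat-<lex-∷ {E = (_ ∷ _) ∷ _} _                (this c<x ∷ _) = this c<x
concat-<lex-∷ {E = (_ ∷ _) ∷ _} (_ ∷ edges) (next refl (base _) ∷ desc) =
  next refl (concat-<lex-∷ edges desc)

DescentsDecrease : List ℕ → Set
DescentsDecrease T = (j a b : ℕ) (rest : List ℕ) →
  drop j T ≡ a ∷ b ∷ rest → b ≤ a → drop (suc j) T <lex drop j T

descentsDecrease-[] : DescentsDecrease []
descentsDecrease-[] zero    _ _ _ ()
descentsDecrease-[] (suc j) _ _ _ ()

descentsDecrease-∷ : ∀ {x T} → T <lex (x ∷ T) → DescentsDecrease T →
                     DescentsDecrease (x ∷ T)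
descentsDecrease-∷ T<x∷T _  zero    _ _ _ _ _ = T<x∷T
descentsDecrease-∷ _     dd (suc j)           = dd j

descentsDecrease-∷< : ∀ {x y T} → x < y → DescentsDecrease (y ∷ T) →
                      DescentsDecrease (x ∷ y ∷ T)
descentsDecrease-∷< x<y _  zero    _ _ _ refl y≤x = contradiction y≤x (<⇒≱ x<y)
descentsDecrease-∷< _   dd (suc j)                = dd j

descentsDecrease-edge++ : ∀ {p y s E} → Linked _<_ (y ∷ s) → All (IsEdge p) E →
                          DescLex ((y ∷ s) ∷ E) → DescentsDecrease (concat E) →
                          DescentsDecrease (y ∷ s ++ concat E)
descentsDecrease-edge++ {s = []}    _           edges desc dd =
  descentsDecrease-∷ (concat-<lex-∷ edges desc) dd
descentsDecrease-edge++ {s = _ ∷ _} (y<z ∷ asc) edges desc dd =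
  descentsDecrease-∷< y<z
    (descentsDecrease-edge++ asc edges (descLex-weakenHead (this y<z) desc) dd)

descentsDecrease-concat : ∀ {p E} → All (IsEdge p) E → DescLex E →
                          DescentsDecrease (concat E)
descentsDecrease-concat []                                  _ = descentsDecrease-[]
descentsDecrease-concat {E = [] ∷ _}      ((e≢[] , _) ∷ _) _ = contradiction refl e≢[]
descentsDecrease-concat {E = (_ ∷ _) ∷ _} ((_ , asc , _) ∷ edges) desc =
  descentsDecrease-edge++ asc edges desc
    (descentsDecrease-concat edges (Linked.tail desc))

theorem1 : (p : ℕ) (E : List (List ℕ)) →
    All (IsEdge p) E → DescLex E →
    (j a b : ℕ) (rest : List ℕ) →
    drop j (stringT E) ≡ a ∷ b ∷ rest → b ≤ a →
    drop (suc j) (stringT E) <lex drop j (stringT E)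
theorem1 p E = descentsDecrease-concat
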